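{- Let $G$ be a graph on $n$ vertices whose list chromatic number is $s$. Then for every positive integer $t < s$, $\lambda_t(G) \geq \frac{tn}{tw(G)+1}$, where $tw(G)$ is the treewidth of $G$.
   Context: The treewidth $tw(G)$ equals one less than the minimum, over all chordal supergraphs $G'$ of $G$ on the same vertex set, of the clique number of $G'$. For a graph $G$ and a positive integer $k$, a $k$-assignment is a function assigning to each vertex $v$ a list $l(v)$ of exactly $k$ colours. $G$ is $\mathcal{L}$-list colourable if there is a proper vertex colouring in which each vertex $v$ receives a colour from $l(v)$; $G$ is $k$-choosable if it is $\mathcal{L}$-list colourable for every $k$-assignment $\mathcal{L}$. The list chromatic number $\chi_L(G)$ is the least $k$ such that $G$ is $k$-choosable. For a $t$-assignment $\mathcal{L}_t$, $\lambda_{\mathcal{L}_t}(G)$ is the maximum number of vertices of an induced subgraph of $G$ that is $\mathcal{L}_t$-list colourable, and $\lambda_t(G) = \min\{\lambda_{\mathcal{L}_t}(G) : \mathcal{L}_t \text{ a } t\text{ -assignment for } G\}$. -}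

module Defs where

open import Data.Nat using (ℕ; zero; suc; _+_; _*_; _≤_; _<_; _≟_)
open import Relation.Nullary.Decidable using (does)
open import Data.Bool using (if_then_else_)
open import Data.Fin using (Fin; toℕ)
open import Data.Fin.Subset using (Subset; _∈_; ∣_∣)
open import Data.Bool using (Bool; true; false)
open import Data.List using (List; length)
open import Data.List.Relation.Unary.Unique.Propositional using (Unique)
import Data.List.Membership.Propositional as LM
open import Data.Product using (Σ; ∃; _×_; _,_)
open import Data.Sum using (_⊎_)
open import Relation.Binary.PropositionalEquality using (_≡_; _≢_)
open import Relation.Nullary using (¬_)
open import Function.Definitions using (Injective)

record Graph (n : ℕ) : Set where
  field
    adj    : Fin n → Fin n → Bool
    sym    : ∀ u v → adj u v ≡ adj v u
    irrefl : ∀ v → adj v v ≡ false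
open Graph public

Adj : ∀ {n} → Graph n → Fin n → Fin n → Set
Adj G u v = adj G u v ≡ true

Supergraph : ∀ {n} → Graph n → Graph n → Set
Supergraph G H = ∀ u v → Adj G u v → Adj H u v

nxt : ℕ → ℕ → ℕ
nxt m i = if does (suc i ≟ m) then 0 else suc i

record Cycle {n} (G : Graph n) (m : ℕ) : Set where
  field
    vtx      : ℕ → Fin n               -- only indices < m matter
    inj      : ∀ i j → i < m → j < m → vtx i ≡ vtx j → i ≡ j
    edges    : ∀ i → i < m → Adj G (vtx i) (vtx (nxt m i))
open Cycle public

Consecutive : ℕ → ℕ → ℕ → Set
Consecutive m i j = (j ≡ nxt m i) ⊎ (i ≡ nxt m j)

HasChord : ∀ {n} {G : Graph n} {m} → Cycle G m → Set
HasChord {G = G} {m} C =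
  Σ ℕ λ i → Σ ℕ λ j → i < m × j < m × ¬ (i ≡ j) × ¬ Consecutive m i j
    × Adj G (vtx C i) (vtx C j)

Chordal : ∀ {n} → Graph n → Set
Chordal G = ∀ m → 4 ≤ m → (C : Cycle G m) → HasChord C

IsClique : ∀ {n} → Graph n → Subset n → Set
IsClique G S = ∀ u v → u ∈ S → v ∈ S → u ≢ v → Adj G u v

IsCliqueNumber : ∀ {n} → Graph n → ℕ → Set
IsCliqueNumber G ω =
  (Σ (Subset _) λ S → IsClique G S × ∣ S ∣ ≡ ω)
  × (∀ S → IsClique G S → ∣ S ∣ ≤ ω)

-- k = tw(G) + 1 = min over chordal supergraphs G' of G of ω(G').
-- (Stated as tw+1 so that it is a natural number also for the empty graph.)
IsTreewidthPlusOne : ∀ {n} → Graph n → ℕ → Set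
IsTreewidthPlusOne {n} G k =
  (Σ (Graph n) λ H → Supergraph G H × Chordal H × IsCliqueNumber H k)
  × (∀ H ω → Supergraph G H → Chordal H → IsCliqueNumber H ω → k ≤ ω)

record Assignment (n k : ℕ) : Set where
  field
    lst    : Fin n → List ℕ
    size   : ∀ v → length (lst v) ≡ k
    unique : ∀ v → Unique (lst v)
open Assignment public

InducedColourable : ∀ {n k} → Graph n → Assignment n k → Subset n → Set
InducedColourable G L S =
  Σ (Fin _ → ℕ) λ c →
    (∀ v → v ∈ S → c v LM.∈ lst L v)
    × (∀ u v → u ∈ S → v ∈ S → Adj G u v → c u ≢ c v)

Colourable : ∀ {n k} → Graph n → Assignment n k → Set
Colourable {n} G L = Σ (Fin n → ℕ) λ c →
    (∀ v → c v LM.∈ lst L v) × (∀ u v → Adj G u v → c u ≢ c v)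

Choosable : ∀ {n} → Graph n → ℕ → Set
Choosable {n} G k = (L : Assignment n k) → Colourable G L

IsListChromaticNumber : ∀ {n} → Graph n → ℕ → Set
IsListChromaticNumber G s = Choosable G s × (∀ k → k < s → ¬ Choosable G k)

IsLambdaL : ∀ {n k} → Graph n → Assignment n k → ℕ → Set
IsLambdaL G L m =
  (Σ (Subset _) λ S → InducedColourable G L S × ∣ S ∣ ≡ m)
  × (∀ S → InducedColourable G L S → ∣ S ∣ ≤ m)

IsLambda : ∀ {n} → Graph n → ℕ → ℕ → Set
IsLambda {n} G t m =
  (Σ (Assignment n t) λ L → IsLambdaL G L m)
  × (∀ (L : Assignment n t) m' → IsLambdaL G L m' → m ≤ m')

-- Let H be a chordal supergraph of G with clique number k = tw(G) + 1. A chordal graph always has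
-- a simplicial vertex (Dirac), so colouring greedily in reverse elimination order shows that every
-- induced subgraph of H with cliques of size at most b is b-choosable; in particular G is
-- k-choosable, so t < s ≤ k. Fix a proper colouring f of H with colours 0, …, k − 1 and, for
-- j < k, the window S_j of the vertices v with (j + f v) mod k < t, i.e. t cyclically consecutive
-- colour classes. Every vertex lies in exactly t windows, so some window has at least tn/k vertices.
-- A clique inside a window has distinct colours among t, so H[S_j], and with it G[S_j], is
-- L-colourable for every t-assignment L, whence λ_L(G) ≥ tn/k.

module Submission where

open import Defs hiding (sym)
open import Data.Nat
  using (ℕ; zero; suc; _+_; _*_; _∸_; _≤_; _<_; z≤n; s≤s; z<s; _≤?_; _<?_; _≟_; _≡ᵇ_; NonZero; >-nonZero)
open import Data.Nat.Properties
import Data.Bool as Bool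
open import Data.Bool using (Bool; true; false)
open import Data.Unit using (tt)
open import Data.Fin using (Fin; zero; suc; toℕ; inject₁; fromℕ)
open import Data.Fin.Properties using (toℕ-inject₁; toℕ-fromℕ; toℕ<n)
  renaming (any? to any?ᶠ; _≟_ to _≟ᶠ_; suc-injective to suc-injectiveᶠ)
open import Data.Fin.Subset
  using (Subset; _∈_; _∉_; _⊆_; _⊂_; _∪_; ∣_∣; inside; outside; ⁅_⁆; ⊤) renaming (⊥ to ∅)
open import Data.Fin.Subset.Properties
  using (_∈?_; p⊂q⇒∣p∣<∣q∣; ∣p∣≤n; x∈⁅x⁆; x∈⁅y⁆⇒x≡y; x∈p∪q⁺; x∈p∪q⁻; p⊆p∪q; ∉⊥; nonempty?; ∈⊤)
open import Data.Vec using ([]; _∷_; here; there)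
open import Data.List using (List; []; _∷_; length; map; _++_; [_]; upTo)
open import Data.List.Properties using (length-map; length-++; length-upTo)
import Data.List.Relation.Unary.All as All
import Data.List.Relation.Unary.All.Properties as AllProp
open import Data.List.Relation.Unary.Any using (any?; here; there)
open import Data.List.Relation.Unary.AllPairs using ([]; _∷_)
open import Data.List.Relation.Unary.Unique.Propositional using (Unique)
open import Data.List.Relation.Unary.Unique.Propositional.Properties using (upTo⁺)
open import Data.List.Membership.Propositional using (find; lose) renaming (_∈_ to _∈ₗ_; _∉_ to _∉ₗ_)
open import Data.List.Membership.Propositional.Properties
  using (∈-upTo⁺; ∈-upTo⁻; ∈-map⁺; ∈-map⁻; ∈-∃++; ∈-++⁺ˡ; ∈-++⁺ʳ; ∈-++⁻)
import Data.List.Membership.DecPropositional as DecMembership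
open import Data.List.Relation.Binary.Subset.Propositional using () renaming (_⊆_ to _⊆ₗ_)
open import Data.Product using (Σ; ∃; ∃₂; _×_; _,_; proj₁; proj₂)
open import Data.Sum using (_⊎_; inj₁; inj₂)
import Data.Sum as Sum
open import Data.Empty using (⊥-elim)
open import Function using (_∘_)
open import Relation.Binary.Definitions using (DecidableEquality; tri<; tri≈; tri>)
open import Relation.Binary.PropositionalEquality
  using (_≡_; _≢_; refl; sym; trans; cong; cong₂; subst; subst₂; module ≡-Reasoning)
open import Relation.Nullary using (¬_; Dec; yes; no; does; ¬?; map′)
open import Relation.Nullary.Decidable using (decidable-stable; _×-dec_; _⊎-dec_)
open import Relation.Unary using (Pred; Decidable)
open import Relation.Binary.Core using (Rel)
open import Relation.Binary.Construct.Closure.ReflexiveTransitive using (Star; ε; _◅_; _◅◅_)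
import Relation.Binary.Construct.Closure.ReflexiveTransitive as Star
open import Level using (0ℓ)
open import Algebra.Properties.CommutativeMonoid.Sum +-0-commutativeMonoid
  using (sum; sum-syntax; sum-cong-≗; sum-init-last; ∑-comm)
open import Data.Nat.Induction using (<-wellFounded)
open import Data.Nat.DivMod using (_%_; m<n⇒m%n≡m; [m+n]%n≡m%n; m%n<n; %-distribˡ-+)
open import Induction.WellFounded using (Acc; acc)

private
  variable
    A B : Set
    n : ℕ

∈-remove : ∀ {x : A} {ys} → x ∈ₗ ys →
  ∃ λ zs → length ys ≡ suc (length zs) × (∀ {z} → z ∈ₗ ys → z ≢ x → z ∈ₗ zs)
∈-remove {x = x} x∈ys with as , bs , refl ← ∈-∃++ x∈ys =
  as ++ bs , trans (length-++ as) (trans (+-suc _ _) (cong suc (sym (length-++ as)))) , keep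
  where
  keep : ∀ {z} → z ∈ₗ as ++ [ x ] ++ bs → z ≢ x → z ∈ₗ as ++ bs
  keep z∈ z≢x with ∈-++⁻ as z∈
  ... | inj₁ z∈as = ∈-++⁺ˡ z∈as
  ... | inj₂ (here z≡x) = ⊥-elim (z≢x z≡x)
  ... | inj₂ (there z∈bs) = ∈-++⁺ʳ as z∈bs

length-mono-⊆ : {xs ys : List A} → Unique xs → xs ⊆ₗ ys → length xs ≤ length ys
length-mono-⊆ {xs = []} _ _ = z≤n
length-mono-⊆ {xs = x ∷ xs} (x∉xs ∷ uxs) xs⊆ys with zs , eq , keep ← ∈-remove (xs⊆ys (here refl)) =
  subst (suc (length xs) ≤_) (sym eq)
    (s≤s (length-mono-⊆ uxs (λ z∈xs → keep (xs⊆ys (there z∈xs)) (λ z≡x → All.lookup x∉xs z∈xs (sym z≡x)))))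

map-unique : (f : A → B) {xs : List A} →
  (∀ {x y} → x ∈ₗ xs → y ∈ₗ xs → f x ≡ f y → x ≡ y) → Unique xs → Unique (map f xs)
map-unique f {[]} _ [] = []
map-unique f {x ∷ xs} inj (x∉xs ∷ uxs) =
  AllProp.map⁺ (All.tabulate (λ y∈xs fx≡fy → All.lookup x∉xs y∈xs (inj (here refl) (there y∈xs) fx≡fy)))
    ∷ map-unique f (λ x∈ y∈ → inj (there x∈) (there y∈)) uxs

module _ (_≟_ : DecidableEquality A) where
  open DecMembership _≟_ using () renaming (_∈?_ to _∈ₗ?_)

  ∃-∉-longer : {xs ys : List A} → Unique xs → length ys < length xs → ∃ λ x → x ∈ₗ xs × x ∉ₗ ys
  ∃-∉-longer {xs} {ys} uxs ys<xs with any? (λ x → ¬? (x ∈ₗ? ys)) xs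
  ... | yes x∉ys = find x∉ys
  ... | no ¬x∉ys = ⊥-elim (<⇒≱ ys<xs (length-mono-⊆ uxs xs⊆ys))
    where
    xs⊆ys : xs ⊆ₗ ys
    xs⊆ys {x} x∈xs = decidable-stable (x ∈ₗ? ys) (¬x∉ys ∘ lose x∈xs)

select : {P : Pred (Fin n) 0ℓ} → Decidable P → Subset n
select {zero} P? = []
select {suc n} P? = does (P? zero) ∷ select (P? ∘ suc)

∈-select⁺ : ∀ {P : Pred (Fin n) 0ℓ} {P? : Decidable P} {x} → P x → x ∈ select P?
∈-select⁺ {P? = P?} {zero} px with P? zero
... | yes _ = here
... | no ¬px = ⊥-elim (¬px px)
∈-select⁺ {P? = P?} {suc x} px = there (∈-select⁺ {P? = P? ∘ suc} px)

∈-select⁻ : ∀ {P : Pred (Fin n) 0ℓ} {P? : Decidable P} {x} → x ∈ select P? → P x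
∈-select⁻ {P? = P?} {zero} x∈ with P? zero | x∈
... | yes px | _ = px
∈-select⁻ {P? = P?} {suc x} (there x∈) = ∈-select⁻ {P? = P? ∘ suc} x∈

_∖_ : Subset n → Fin n → Subset n
U ∖ s = select (λ w → w ∈? U ×-dec ¬? (w ≟ᶠ s))

elements : Subset n → List (Fin n)
elements [] = []
elements (inside ∷ p) = zero ∷ map suc (elements p)
elements (outside ∷ p) = map suc (elements p)

∈-elements⁺ : ∀ {p : Subset n} {x} → x ∈ p → x ∈ₗ elements p
∈-elements⁺ here = here refl
∈-elements⁺ {p = inside ∷ p} (there x∈p) = there (∈-map⁺ suc (∈-elements⁺ x∈p))
∈-elements⁺ {p = outside ∷ p} (there x∈p) = ∈-map⁺ suc (∈-elements⁺ x∈p)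

∈-elements⁻ : ∀ {p : Subset n} {x} → x ∈ₗ elements p → x ∈ p
∈-elements⁻ {p = inside ∷ p} (here refl) = here
∈-elements⁻ {p = inside ∷ p} (there x∈) with y , y∈ , refl ← ∈-map⁻ suc x∈ = there (∈-elements⁻ y∈)
∈-elements⁻ {p = outside ∷ p} x∈ with y , y∈ , refl ← ∈-map⁻ suc x∈ = there (∈-elements⁻ y∈)

elements-unique : (p : Subset n) → Unique (elements p)
elements-unique [] = []
elements-unique (inside ∷ p) =
  AllProp.map⁺ (All.universal (λ _ ()) (elements p))
    ∷ map-unique suc (λ _ _ → suc-injectiveᶠ) (elements-unique p)
elements-unique (outside ∷ p) = map-unique suc (λ _ _ → suc-injectiveᶠ) (elements-unique p)

length-elements : (p : Subset n) → length (elements p) ≡ ∣ p ∣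
length-elements [] = refl
length-elements (inside ∷ p) = cong suc (trans (length-map suc (elements p)) (length-elements p))
length-elements (outside ∷ p) = trans (length-map suc (elements p)) (length-elements p)

∣p∣≤length-by-injection : ∀ {p : Subset n} (h : Fin n → A) {xs} →
  (∀ {v} → v ∈ p → h v ∈ₗ xs) → (∀ {u v} → u ∈ p → v ∈ p → h u ≡ h v → u ≡ v) → ∣ p ∣ ≤ length xs
∣p∣≤length-by-injection {p = p} h {xs} into inj =
  subst (_≤ length xs) (trans (length-map h (elements p)) (length-elements p))
    (length-mono-⊆ (map-unique h (λ u∈ v∈ → inj (∈-elements⁻ u∈) (∈-elements⁻ v∈)) (elements-unique p))
      (λ hv∈ → let v , v∈ , eq = ∈-map⁻ h hv∈ in subst (_∈ₗ xs) (sym eq) (into (∈-elements⁻ v∈))))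

∃-∉-image : (_≟_ : DecidableEquality A) {xs : List A} → Unique xs →
  (N : Subset n) → ∣ N ∣ < length xs → (c : Fin n → A) → ∃ λ x → x ∈ₗ xs × (∀ {w} → w ∈ N → c w ≢ x)
∃-∉-image _≟_ uxs N N<xs c
  with x , x∈xs , x∉cN ← ∃-∉-longer _≟_ {ys = map c (elements N)} uxs
         (subst (_< _) (sym (trans (length-map c (elements N)) (length-elements N))) N<xs) =
  x , x∈xs , λ w∈N cw≡x → x∉cN (subst (_∈ₗ _) cw≡x (∈-map⁺ c (∈-elements⁺ w∈N)))

module Closure (f : Subset n → Subset n)
  (inflationary : ∀ S → S ⊆ f S) (monotone : ∀ {S T} → S ⊆ T → f S ⊆ f T) (S₀ : Subset n) where

  stage : ℕ → Subset n
  stage zero = S₀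
  stage (suc i) = f (stage i)

  closed-or-growing : ∀ i → f (stage i) ⊆ stage i ⊎ i ≤ ∣ stage i ∣
  closed-or-growing zero = inj₂ z≤n
  closed-or-growing (suc i) with any?ᶠ (λ x → x ∈? f (stage i) ×-dec ¬? (x ∈? stage i))
  ... | no ¬new = inj₁ (monotone (λ {x} x∈ → decidable-stable (x ∈? stage i) (λ x∉ → ¬new (x , x∈ , x∉))))
  ... | yes (x , x∈ , x∉) with closed-or-growing i
  ...   | inj₁ closed = ⊥-elim (x∉ (closed x∈))
  ...   | inj₂ i≤ = inj₂ (≤-trans (s≤s i≤) (p⊂q⇒∣p∣<∣q∣ (inflationary (stage i) , x , x∈ , x∉)))

  closure : Subset n
  closure = stage (suc n)

  closure-closed : f closure ⊆ closure
  closure-closed with closed-or-growing (suc n)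
  ... | inj₁ closed = closed
  ... | inj₂ n<∣closure∣ = ⊥-elim (<⇒≱ n<∣closure∣ (∣p∣≤n closure))

𝟙 : Bool → ℕ
𝟙 true = 1
𝟙 false = 0

∣select∣≡∑ : ∀ {P : Pred (Fin n) 0ℓ} (P? : Decidable P) → ∣ select P? ∣ ≡ ∑[ v < n ] 𝟙 (does (P? v))
∣select∣≡∑ {zero} P? = refl
∣select∣≡∑ {suc n} P? with does (P? zero)
... | true = cong suc (∣select∣≡∑ (P? ∘ suc))
... | false = ∣select∣≡∑ (P? ∘ suc)

∑-const : ∀ n c → ∑[ i < n ] c ≡ n * c
∑-const zero c = refl
∑-const (suc n) c = cong (c +_) (∑-const n c)

∃-≥-average : ∀ {k} .{{_ : NonZero k}} (a : Fin k → ℕ) → ∃ λ j → sum a ≤ k * a j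
∃-≥-average {suc zero} a = zero , ≤-refl
∃-≥-average {suc (suc k)} a with j , bound ← ∃-≥-average (a ∘ suc) with a zero ≤? a (suc j)
... | yes a₀≤aⱼ = suc j , +-mono-≤ a₀≤aⱼ bound
... | no a₀≰aⱼ = zero , +-monoʳ-≤ (a zero) (≤-trans bound (*-monoʳ-≤ (suc k) (<⇒≤ (≰⇒> a₀≰aⱼ))))

∑-periodic-shift : ∀ k (g : ℕ → ℕ) → (∀ i → g (k + i) ≡ g i) →
  ∀ c → ∑[ j < k ] g (toℕ j + c) ≡ ∑[ j < k ] g (toℕ j)
∑-periodic-shift k g periodic zero = sum-cong-≗ {k} (λ j → cong g (+-identityʳ (toℕ j)))
∑-periodic-shift k g periodic (suc c) = trans (shift-by-one k periodic) (∑-periodic-shift k g periodic c)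
  where
  open ≡-Reasoning
  shift-by-one : ∀ k → (∀ i → g (k + i) ≡ g i) → ∑[ j < k ] g (toℕ j + suc c) ≡ ∑[ j < k ] g (toℕ j + c)
  shift-by-one zero _ = refl
  shift-by-one (suc k) periodic = begin
    ∑[ j < suc k ] g (toℕ j + suc c)                                   ≡⟨ sum-init-last (λ j → g (toℕ j + suc c)) ⟩
    ∑[ j < k ] g (toℕ (inject₁ j) + suc c) + g (toℕ (fromℕ k) + suc c) ≡⟨ cong₂ _+_ (sum-cong-≗ {k} inner) last ⟩
    ∑[ j < k ] g (suc (toℕ j) + c) + g c                               ≡⟨ +-comm _ (g c) ⟩
    g c + ∑[ j < k ] g (suc (toℕ j) + c)                               ∎
    where
    inner : ∀ j → g (toℕ (inject₁ j) + suc c) ≡ g (suc (toℕ j) + c)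
    inner j = cong g (trans (cong (_+ suc c) (toℕ-inject₁ j)) (+-suc (toℕ j) c))
    last : g (toℕ (fromℕ k) + suc c) ≡ g c
    last = trans (cong g (trans (cong (_+ suc c) (toℕ-fromℕ k)) (+-suc k c))) (periodic c)

∑-𝟙-< : ∀ {k t} → t ≤ k → ∑[ j < k ] 𝟙 (does (toℕ j <? t)) ≡ t
∑-𝟙-< {zero} z≤n = refl
∑-𝟙-< {suc k} {zero} _ = trans (∑-const (suc k) 0) (*-zeroʳ (suc k))
∑-𝟙-< {suc k} {suc t} (s≤s t≤k) = cong suc (∑-𝟙-< t≤k)

module _ (k : ℕ) .{{_ : NonZero k}} where

  [j+a]%k-injective : ∀ j {a b} → a < k → b < k → (j + a) % k ≡ (j + b) % k → a ≡ b
  [j+a]%k-injective j {a} {b} a<k b<k eq = trans (recover a<k) (trans (cong undo eq) (sym (recover b<k)))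
    where
    r : ℕ
    r = j % k
    undo : ℕ → ℕ
    undo z = ((k ∸ r) % k + z) % k
    recover : ∀ {a} → a < k → a ≡ undo ((j + a) % k)
    recover {a} a<k = begin
      a                                       ≡⟨ m<n⇒m%n≡m a<k ⟨
      a % k                                   ≡⟨ [m+n]%n≡m%n a k ⟨
      (a + k) % k                             ≡⟨ cong (_% k) (+-comm a k) ⟩
      (k + a) % k                             ≡⟨ cong (λ z → (z + a) % k) (m∸n+n≡m (<⇒≤ (m%n<n j k))) ⟨
      (k ∸ r + r + a) % k                     ≡⟨ cong (_% k) (+-assoc (k ∸ r) r a) ⟩
      (k ∸ r + (r + a)) % k                   ≡⟨ %-distribˡ-+ (k ∸ r) (r + a) k ⟩
      ((k ∸ r) % k + (r + a) % k) % k          ≡⟨ cong undo r+a≡j+a ⟩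
      undo ((j + a) % k)                      ∎
      where
      open ≡-Reasoning
      r+a≡j+a : (r + a) % k ≡ (j + a) % k
      r+a≡j+a = begin
        (r + a) % k           ≡⟨ cong (λ z → (r + z) % k) (m<n⇒m%n≡m a<k) ⟨
        (r + a % k) % k       ≡⟨ %-distribˡ-+ j a k ⟨
        (j + a) % k           ∎

  window-count : ∀ {t} → t ≤ k → ∀ c → ∑[ j < k ] 𝟙 (does ((toℕ j + c) % k <? t)) ≡ t
  window-count {t} t≤k c = begin
    ∑[ j < k ] g (toℕ j + c)     ≡⟨ ∑-periodic-shift k g periodic c ⟩
    ∑[ j < k ] g (toℕ j)         ≡⟨ sum-cong-≗ {k} (λ j → cong (λ z → 𝟙 (does (z <? t))) (m<n⇒m%n≡m (toℕ<n j))) ⟩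
    ∑[ j < k ] 𝟙 (does (toℕ j <? t)) ≡⟨ ∑-𝟙-< t≤k ⟩
    t                            ∎
    where
    open ≡-Reasoning
    g : ℕ → ℕ
    g i = 𝟙 (does (i % k <? t))
    periodic : ∀ i → g (k + i) ≡ g i
    periodic i = cong (λ z → 𝟙 (does (z <? t))) (trans (cong (_% k) (+-comm k i)) ([m+n]%n≡m%n i k))

-- Walks and chordless cycles

nxt-≡ : ∀ {M i} → suc i ≡ M → nxt M i ≡ 0
nxt-≡ {M} {i} e with suc i ≡ᵇ M | ≡⇒≡ᵇ (suc i) M e
... | true | _ = refl

nxt-≢ : ∀ {M i} → suc i ≢ M → nxt M i ≡ suc i
nxt-≢ {M} {i} ≢ with suc i ≡ᵇ M | ≡ᵇ⇒≡ (suc i) M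
... | true | ≡ = ⊥-elim (≢ (≡ tt))
... | false | _ = refl

module _ {n} (H : Graph n) where

  Adj-sym : ∀ {u v} → Adj H u v → Adj H v u
  Adj-sym {u} {v} = trans (Graph.sym H v u)

  Adj-irrefl : ∀ {v} → ¬ Adj H v v
  Adj-irrefl {v} v~v with () ← trans (sym v~v) (irrefl H v)

  Adj? : ∀ u v → Dec (Adj H u v)
  Adj? u v = adj H u v Bool.≟ Bool.true

  Far : Fin n → Pred (Fin n) 0ℓ
  Far v w = w ≢ v × ¬ Adj H v w

  Far? : ∀ v w → Dec (Far v w)
  Far? v w = ¬? (w ≟ᶠ v) ×-dec ¬? (Adj? v w)

  Far-sym : ∀ {v w} → Far v w → Far w v
  Far-sym (w≢v , v≁w) = w≢v ∘ sym , v≁w ∘ Adj-sym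

  Edge : Pred (Fin n) 0ℓ → Rel (Fin n) 0ℓ
  Edge P a b = P a × P b × Adj H a b

  Edge-sym : ∀ {P a b} → Edge P a b → Edge P b a
  Edge-sym (pa , pb , a~b) = pb , pa , Adj-sym a~b

  Edge-path-end : ∀ {P a b} → P a → Star (Edge P) a b → P b
  Edge-path-end pa ε = pa
  Edge-path-end _ ((_ , pb , _) ◅ path) = Edge-path-end pb path

  record Walk (P : Pred (Fin n) 0ℓ) (x y : Fin n) : Set where
    field
      len      : ℕ
      vertex   : ℕ → Fin n
      start    : vertex 0 ≡ x
      end      : vertex len ≡ y
      step     : ∀ i → i < len → Adj H (vertex i) (vertex (suc i))
      interior : ∀ i → 0 < i → i < len → P (vertex i)
  open Walk

  module _ {P : Pred (Fin n) 0ℓ} where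

    edge : ∀ {x y} → Adj H x y → Walk P x y
    edge {x} {y} x~y = record
      { len = 1 ; vertex = λ { zero → x ; (suc _) → y } ; start = refl ; end = refl
      ; step = λ { zero _ → x~y ; (suc _) (s≤s ()) } ; interior = λ { zero () ; (suc _) _ (s≤s ()) } }

    cons : ∀ {z x y} → Adj H z x → P x → Walk P x y → Walk P z y
    cons {z} {x} z~x px w = record
      { len = suc (len w) ; vertex = λ { zero → z ; (suc i) → vertex w i } ; start = refl ; end = end w
      ; step = λ { zero _ → subst (Adj H z) (sym (start w)) z~x ; (suc i) (s≤s i<) → step w i i< }
      ; interior = λ { (suc zero) _ _ → subst P (sym (start w)) px
                     ; (suc (suc i)) _ (s≤s i<) → interior w (suc i) (s≤s z≤n) i< } }

    Chord : ∀ {x y} → Walk P x y → Set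
    Chord w = ∃₂ λ i j → 2 + i ≤ j × j ≤ len w × Adj H (vertex w i) (vertex w j)

    chord? : ∀ {x y} (w : Walk P x y) → Dec (Chord w)
    chord? w = map′ (λ (j , j≤m , i , _ , 2+i≤j , i~j) → i , j , 2+i≤j , ≤-pred j≤m , i~j)
                    (λ (i , j , 2+i≤j , j≤m , i~j) → j , s≤s j≤m , i , ≤-trans (n≤1+n _) 2+i≤j , 2+i≤j , i~j)
                    (anyUpTo? (λ j → anyUpTo? (λ i → (2 + i ≤? j) ×-dec Adj? (vertex w i) (vertex w j)) j)
                              (suc (len w)))

    shortcut : ∀ {x y} (w : Walk P x y) → Chord w → Σ (Walk P x y) λ w′ → len w′ < len w
    shortcut {x} {y} w (i , j , 2+i≤j , j≤m , i~j) = w′ , ∸-monoʳ-< (m<n⇒0<n∸m 2+i≤j) d≤m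
      where
      m : ℕ
      m = len w
      p : ℕ → Fin n
      p = vertex w
      d : ℕ
      d = j ∸ suc i
      d≤m : d ≤ m
      d≤m = ≤-trans (m∸n≤m j (suc i)) j≤m
      m∸d+d≡m : m ∸ d + d ≡ m
      m∸d+d≡m = m∸n+n≡m d≤m
      i<m∸d : i < m ∸ d
      i<m∸d = m+n≤o⇒m≤o∸n (suc i) (≤-trans (≤-reflexive (m+[n∸m]≡n (≤-trans (n≤1+n _) 2+i≤j))) j≤m)
      i<m : i < m
      i<m = ≤-trans i<m∸d (m∸n≤m m d)
      shifted : ∀ {k} → k < m ∸ d → k + d < m
      shifted {k} k< = subst (k + d <_) m∸d+d≡m (+-monoˡ-< d k<)
      -- skip the d vertices strictly between positions i and j
      q : ℕ → Fin n
      q k with k ≤? i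
      ... | yes _ = p k
      ... | no _ = p (k + d)
      q-start : q 0 ≡ x
      q-start with 0 ≤? i
      ... | yes _ = start w
      ... | no 0≰i = ⊥-elim (0≰i z≤n)
      q-end : q (m ∸ d) ≡ y
      q-end with m ∸ d ≤? i
      ... | yes m∸d≤i = ⊥-elim (<⇒≱ i<m∸d m∸d≤i)
      ... | no _ = trans (cong p m∸d+d≡m) (end w)
      q-step : ∀ k → k < m ∸ d → Adj H (q k) (q (suc k))
      q-step k k< with k ≤? i | suc k ≤? i
      ... | yes _ | yes k<i = step w k (<-trans k<i i<m)
      ... | yes k≤i | no k≮i with refl ← ≤-antisym k≤i (≤-pred (≰⇒> k≮i)) =
        subst (Adj H (p k) ∘ p) (sym (m+[n∸m]≡n (≤-trans (n≤1+n _) 2+i≤j))) i~j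
      ... | no k≰i | yes k<i = ⊥-elim (k≰i (<⇒≤ k<i))
      ... | no _ | no _ = step w (k + d) (shifted k<)
      q-interior : ∀ k → 0 < k → k < m ∸ d → P (q k)
      q-interior k 0<k k< with k ≤? i
      ... | yes k≤i = interior w k 0<k (≤-<-trans k≤i i<m)
      ... | no _ = interior w (k + d) (≤-trans 0<k (m≤m+n k d)) (shifted k<)
      w′ : Walk P x y
      w′ = record { len = m ∸ d ; vertex = q ; start = q-start ; end = q-end ; step = q-step ; interior = q-interior }

    chordless-walk : ∀ {x y} → Walk P x y → Σ (Walk P x y) (¬_ ∘ Chord)
    chordless-walk w = go w (<-wellFounded (len w))
      where
      go : ∀ {x y} (w : Walk P x y) → Acc _<_ (len w) → Σ (Walk P x y) (¬_ ∘ Chord)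
      go w (acc shorter) with chord? w
      ... | no ¬chord = w , ¬chord
      ... | yes chord with w′ , w′<w ← shortcut w chord = go w′ (shorter w′<w)

  Walk-map : ∀ {P Q : Pred (Fin n) 0ℓ} {x y} → (∀ {z} → P z → Q z) → Walk P x y → Walk Q x y
  Walk-map P⇒Q w = record
    { len = len w ; vertex = vertex w ; start = start w ; end = end w ; step = step w
    ; interior = λ i 0<i i< → P⇒Q (interior w i 0<i i<) }

  walk-through : ∀ {P a c d b} → Adj H a c → P c → Star (Edge P) c d → Adj H d b → Walk P a b
  walk-through a~c pc ε d~b = cons a~c pc (edge d~b)
  walk-through a~c pc ((_ , pc′ , c~c′) ◅ path) d~b = cons a~c pc (walk-through c~c′ pc′ path d~b)

  -- v followed by a chordless walk from x to y that avoids N[v] is a chordless cycle of length ≥ 4.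
  module ChordlessCycle {v x y} (v~x : Adj H v x) (v~y : Adj H v y) (x≢y : x ≢ y) (x≁y : ¬ Adj H x y)
                        (w : Walk (Far v) x y) (¬chord : ¬ Chord w) where

    m : ℕ
    m = len w

    p : ℕ → Fin n
    p = vertex w

    2≤m : 2 ≤ m
    2≤m = ≤∧≢⇒< (n≢0⇒n>0 m≢0) (m≢1 ∘ sym)
      where
      m≢0 : m ≢ 0
      m≢0 m≡0 = x≢y (trans (sym (start w)) (trans (cong p (sym m≡0)) (end w)))
      m≢1 : m ≢ 1
      m≢1 m≡1 = x≁y (subst₂ (Adj H) (start w) (trans (cong p (sym m≡1)) (end w))
                                (step w 0 (subst (0 <_) (sym m≡1) z<s)))

    ends-at-y : ∀ {i} → i ≡ m → p i ≡ y
    ends-at-y i≡m = trans (cong p i≡m) (end w)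

    p≢v : ∀ i → i ≤ m → p i ≢ v
    p≢v zero _ p0≡v = Adj-irrefl (subst (Adj H v) (trans (sym (start w)) p0≡v) v~x)
    p≢v (suc i) i< with suc i ≟ m
    ... | yes e = λ p≡v → Adj-irrefl (subst (Adj H v) (trans (sym (ends-at-y e)) p≡v) v~y)
    ... | no ≢m = proj₁ (interior w (suc i) z<s (≤∧≢⇒< i< ≢m))

    p-injective : ∀ {i j} → i < j → j ≤ m → p i ≢ p j
    p-injective {i} {j} i<j j≤m pi≡pj with m≤n⇒m<n∨m≡n i<j
    ... | inj₂ refl = Adj-irrefl (subst (Adj H (p i)) (sym pi≡pj) (step w i j≤m))
    ... | inj₁ i+1<j with i
    ...   | suc i = ¬chord (i , j , <⇒≤ i+1<j , j≤m ,
                        subst (Adj H (p i)) pi≡pj (step w i (<-≤-trans (<-trans (n<1+n i) i<j) j≤m)))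
    ...   | zero with j ≟ m
    ...     | yes e = x≢y (trans (sym (start w)) (trans pi≡pj (ends-at-y e)))
    ...     | no ≢m = proj₂ (interior w j (<-trans z<s i+1<j) (≤∧≢⇒< j≤m ≢m))
                            (subst (Adj H v) (trans (sym (start w)) pi≡pj) v~x)

    M : ℕ
    M = 2 + m

    c : ℕ → Fin n
    c zero = v
    c (suc i) = p i

    c-injective : ∀ i j → i < M → j < M → c i ≡ c j → i ≡ j
    c-injective zero zero _ _ _ = refl
    c-injective zero (suc j) _ j< v≡pj = ⊥-elim (p≢v j (≤-pred (≤-pred j<)) (sym v≡pj))
    c-injective (suc i) zero i< _ pi≡v = ⊥-elim (p≢v i (≤-pred (≤-pred i<)) pi≡v)
    c-injective (suc i) (suc j) i< j< pi≡pj with <-cmp i j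
    ... | tri< i<j _ _ = ⊥-elim (p-injective i<j (≤-pred (≤-pred j<)) pi≡pj)
    ... | tri≈ _ i≡j _ = cong suc i≡j
    ... | tri> _ _ j<i = ⊥-elim (p-injective j<i (≤-pred (≤-pred i<)) (sym pi≡pj))

    c-edges : ∀ i → i < M → Adj H (c i) (c (nxt M i))
    c-edges zero _ = subst (Adj H v ∘ c) (sym (nxt-≢ {M} (λ ()))) (subst (Adj H v) (sym (start w)) v~x)
    c-edges (suc i) i< with i ≟ m
    ... | yes i≡m = subst (Adj H (p i) ∘ c) (sym (nxt-≡ (cong (2 +_) i≡m)))
                          (Adj-sym (subst (Adj H v) (sym (ends-at-y i≡m)) v~y))
    ... | no i≢m = subst (Adj H (p i) ∘ c) (sym (nxt-≢ (i≢m ∘ suc-injective ∘ suc-injective)))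
                         (step w i (≤∧≢⇒< (≤-pred (≤-pred i<)) i≢m))

    cycle : Cycle H M
    cycle = record { vtx = c ; inj = c-injective ; edges = c-edges }

    ¬v-chord : ∀ j → suc j < M → ¬ Consecutive M 0 (suc j) → ¬ Adj H v (p j)
    ¬v-chord zero _ ¬consecutive _ = ¬consecutive (inj₁ (sym (nxt-≢ {M} (λ ()))))
    ¬v-chord (suc j) j< ¬consecutive with suc j ≟ m
    ... | yes j+1≡m = ⊥-elim (¬consecutive (inj₂ (sym (nxt-≡ (cong (2 +_) j+1≡m)))))
    ... | no j+1≢m = proj₂ (interior w (suc j) z<s (≤∧≢⇒< (≤-pred (≤-pred j<)) j+1≢m))

    ¬p-chord : ∀ {i j} → i < j → j ≤ m → ¬ Consecutive M (suc i) (suc j) → ¬ Adj H (p i) (p j)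
    ¬p-chord {i} {j} i<j j≤m ¬consecutive with m≤n⇒m<n∨m≡n i<j
    ... | inj₂ refl = ⊥-elim (¬consecutive (inj₁ (sym (nxt-≢ (<⇒≢ (s≤s (s≤s j≤m)))))))
    ... | inj₁ i+1<j = λ i~j → ¬chord (i , j , i+1<j , j≤m , i~j)

    ¬chord-cycle : ¬ HasChord cycle
    ¬chord-cycle (zero , zero , _ , _ , i≢j , _) = i≢j refl
    ¬chord-cycle (zero , suc j , _ , j< , _ , ¬consecutive , v~pj) = ¬v-chord j j< ¬consecutive v~pj
    ¬chord-cycle (suc i , zero , i< , _ , _ , ¬consecutive , pi~v) =
      ¬v-chord i i< (¬consecutive ∘ Sum.swap) (Adj-sym pi~v)
    ¬chord-cycle (suc i , suc j , i< , j< , i≢j , ¬consecutive , pi~pj) with <-cmp i j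
    ... | tri< i<j _ _ = ¬p-chord i<j (≤-pred (≤-pred j<)) ¬consecutive pi~pj
    ... | tri≈ _ i≡j _ = i≢j (cong suc i≡j)
    ... | tri> _ _ j<i = ¬p-chord j<i (≤-pred (≤-pred i<)) (¬consecutive ∘ Sum.swap) (Adj-sym pi~pj)

  common-neighbours-adjacent : Chordal H → ∀ {v x y} → Adj H v x → Adj H v y → x ≢ y →
    Walk (Far v) x y → Adj H x y
  common-neighbours-adjacent chordal {x = x} {y} v~x v~y x≢y w with Adj? x y
  ... | yes x~y = x~y
  ... | no x≁y with w′ , ¬chord ← chordless-walk w =
    ⊥-elim (¬chord-cycle (chordal M (s≤s (s≤s 2≤m)) cycle))
    where open ChordlessCycle v~x v~y x≢y x≁y w′ ¬chord

  -- Simplicial vertices and colourings of chordal graphs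

  record ConnectedComponent (W : Subset n) (u : Fin n) : Set where
    field
      members   : Subset n
      root      : u ∈ members
      within    : members ⊆ W
      closed    : ∀ {c w} → c ∈ members → w ∈ W → Adj H c w → w ∈ members
      connected : ∀ {a b} → a ∈ members → b ∈ members → Star (Edge (_∈ W)) a b

  opaque
    connected-component : ∀ W {u} → u ∈ W → ConnectedComponent W u
    connected-component W {u} u∈W = record
      { members = closure
      ; root = root-in (suc n)
      ; within = λ c∈ → Edge-path-end u∈W (reachable-in (suc n) c∈)
      ; closed = λ c∈ w∈W c~w → closure-closed (∈-select⁺ (inj₂ (w∈W , _ , c∈ , c~w)))
      ; connected = λ a∈ b∈ → Star.reverse Edge-sym (reachable-in (suc n) a∈) ◅◅ reachable-in (suc n) b∈
      }
      where
      grow : Subset n → Subset n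
      grow S = select (λ w → w ∈? S ⊎-dec (w ∈? W ×-dec any?ᶠ (λ s → s ∈? S ×-dec Adj? s w)))
      grow-inflationary : ∀ S → S ⊆ grow S
      grow-inflationary S x∈S = ∈-select⁺ (inj₁ x∈S)
      grow-monotone : ∀ {S T} → S ⊆ T → grow S ⊆ grow T
      grow-monotone S⊆T x∈ with ∈-select⁻ x∈
      ... | inj₁ x∈S = ∈-select⁺ (inj₁ (S⊆T x∈S))
      ... | inj₂ (x∈W , s , s∈S , s~x) = ∈-select⁺ (inj₂ (x∈W , s , S⊆T s∈S , s~x))
      open Closure grow grow-inflationary grow-monotone ⁅ u ⁆
      root-in : ∀ i → u ∈ stage i
      root-in zero = x∈⁅x⁆ u
      root-in (suc i) = grow-inflationary _ (root-in i)
      reachable-in : ∀ i {c} → c ∈ stage i → Star (Edge (_∈ W)) u c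
      reachable-in zero c∈ with refl ← x∈⁅y⁆⇒x≡y u c∈ = ε
      reachable-in (suc i) c∈ with ∈-select⁻ c∈
      ... | inj₁ c∈stage = reachable-in i c∈stage
      ... | inj₂ (c∈W , s , s∈stage , s~c) =
        reachable-in i s∈stage ◅◅ ((Edge-path-end u∈W (reachable-in i s∈stage) , c∈W , s~c) ◅ ε)

  Simplicial : Subset n → Fin n → Set
  Simplicial U s = ∀ {a b} → a ∈ U → b ∈ U → Adj H s a → Adj H s b → a ≢ b → Adj H a b

  module Separation (chordal : Chordal H) {U v w} (v∈U : v ∈ U) (w∈U : w ∈ U) (far : Far v w) where

    W : Subset n
    W = select (λ w → w ∈? U ×-dec Far? v w)

    component : ConnectedComponent W w
    component = connected-component W (∈-select⁺ (w∈U , far))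

    open ConnectedComponent component renaming (members to C) public

    C-far : ∀ {c} → c ∈ C → Far v c
    C-far = proj₂ ∘ ∈-select⁻ ∘ within

    X : Subset n
    X = select (λ x → x ∈? U ×-dec Adj? v x ×-dec any?ᶠ (λ c → c ∈? C ×-dec Adj? x c))

    X-clique : IsClique H X
    X-clique a b a∈X b∈X a≢b
      with a∈U , v~a , c₁ , c₁∈C , a~c₁ ← ∈-select⁻ a∈X
         | b∈U , v~b , c₂ , c₂∈C , b~c₂ ← ∈-select⁻ b∈X =
      common-neighbours-adjacent chordal v~a v~b a≢b
        (Walk-map (proj₂ ∘ ∈-select⁻)
          (walk-through a~c₁ (within c₁∈C) (connected c₁∈C c₂∈C) (Adj-sym b~c₂)))

    U′ : Subset n
    U′ = C ∪ X

    C⊆U : C ⊆ U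
    C⊆U = proj₁ ∘ ∈-select⁻ ∘ within

    w∈U′ : w ∈ U′
    w∈U′ = x∈p∪q⁺ (inj₁ root)

    w∉X : w ∉ X
    w∉X w∈X = proj₂ far (proj₁ (proj₂ (∈-select⁻ w∈X)))

    U′⊂U : U′ ⊂ U
    U′⊂U = U′⊆U , v , v∈U , v∉U′
      where
      U′⊆U : U′ ⊆ U
      U′⊆U x∈U′ with x∈p∪q⁻ C X x∈U′
      ... | inj₁ x∈C = C⊆U x∈C
      ... | inj₂ x∈X = proj₁ (∈-select⁻ x∈X)
      v∉U′ : v ∉ U′
      v∉U′ v∈U′ with x∈p∪q⁻ C X v∈U′
      ... | inj₁ v∈C = proj₁ (C-far v∈C) refl
      ... | inj₂ v∈X = Adj-irrefl (proj₁ (proj₂ (∈-select⁻ v∈X)))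

    U′∖X⊆C : ∀ {s} → s ∈ U′ → s ∉ X → s ∈ C
    U′∖X⊆C s∈U′ s∉X with x∈p∪q⁻ C X s∈U′
    ... | inj₁ s∈C = s∈C
    ... | inj₂ s∈X = ⊥-elim (s∉X s∈X)

    neighbour∈U′ : ∀ {s a} → s ∈ C → a ∈ U → Adj H s a → a ∈ U′
    neighbour∈U′ {s} {a} s∈C a∈U s~a with Adj? v a | a ≟ᶠ v
    ... | yes v~a | _ = x∈p∪q⁺ (inj₂ (∈-select⁺ (a∈U , v~a , s , s∈C , Adj-sym s~a)))
    ... | no _ | yes refl = ⊥-elim (proj₂ (C-far s∈C) (Adj-sym s~a))
    ... | no v≁a | no a≢v = x∈p∪q⁺ (inj₁ (closed s∈C (∈-select⁺ (a∈U , a≢v , v≁a)) s~a))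

    simplicial-lift : ∀ {s} → s ∈ C → Simplicial U′ s → Simplicial U s
    simplicial-lift s∈C simplicial a∈U b∈U s~a s~b =
      simplicial (neighbour∈U′ s∈C a∈U s~a) (neighbour∈U′ s∈C b∈U s~b) s~a s~b

  Far-in? : ∀ U v → Dec (∃ λ w → w ∈ U × Far v w)
  Far-in? U v = any?ᶠ (λ w → w ∈? U ×-dec Far? v w)

  clique-or-pivot : ∀ U Q → IsClique H Q →
    (∃ λ v → v ∈ U × (∃ λ w → w ∈ U × Far v w) × (∀ {q} → q ∈ Q → q ∈ U → ¬ Far v q)) ⊎ IsClique H U
  clique-or-pivot U Q Q-clique with any?ᶠ (λ q → q ∈? Q ×-dec q ∈? U ×-dec Far-in? U q)
  ... | yes (q , q∈Q , q∈U , far) =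
    inj₁ (q , q∈U , far , λ q′∈Q _ (q′≢q , q≁q′) → q≁q′ (Q-clique _ _ q∈Q q′∈Q (q′≢q ∘ sym)))
  ... | no ¬far-from-Q with any?ᶠ (λ v → v ∈? U ×-dec Far-in? U v)
  ...   | yes (v , v∈U , far) =
    inj₁ (v , v∈U , far , λ q∈Q q∈U far-vq → ¬far-from-Q (_ , q∈Q , q∈U , v , v∈U , Far-sym far-vq))
  ...   | no ¬far = inj₂ λ a b a∈U b∈U a≢b →
    decidable-stable (Adj? a b) (λ a≁b → ¬far (a , a∈U , b , b∈U , a≢b ∘ sym , a≁b))

  -- The pivot v satisfies Q ∩ U ⊆ N[v]. A simplicial vertex of U′ = C ∪ X outside the clique X
  -- lies in C, hence avoids Q, and is simplicial in U because every U-neighbour of C lies in U′.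
  simplicial-outside-clique : Chordal H → ∀ U Q → IsClique H Q → ∀ {u} → u ∈ U → u ∉ Q →
    ∃ λ s → s ∈ U × s ∉ Q × Simplicial U s
  simplicial-outside-clique chordal U Q Q-clique = go U Q Q-clique (<-wellFounded ∣ U ∣)
    where
    go : ∀ U Q → IsClique H Q → Acc _<_ ∣ U ∣ →
      ∀ {u} → u ∈ U → u ∉ Q → ∃ λ s → s ∈ U × s ∉ Q × Simplicial U s
    go U Q Q-clique (acc smaller) {u} u∈U u∉Q with clique-or-pivot U Q Q-clique
    ... | inj₂ U-clique = u , u∈U , u∉Q , λ a∈U b∈U _ _ a≢b → U-clique _ _ a∈U b∈U a≢b
    ... | inj₁ (v , v∈U , (w , w∈U , far) , Q-near) =
      descend (go U′ X X-clique (smaller (p⊂q⇒∣p∣<∣q∣ U′⊂U)) w∈U′ w∉X)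
      where
      open Separation chordal v∈U w∈U far
      descend : ∃ (λ s → s ∈ U′ × s ∉ X × Simplicial U′ s) → ∃ λ s → s ∈ U × s ∉ Q × Simplicial U s
      descend (s , s∈U′ , s∉X , simplicial) =
        s , C⊆U s∈C , (λ s∈Q → Q-near s∈Q (C⊆U s∈C) (C-far s∈C)) , simplicial-lift s∈C simplicial
        where
        s∈C : s ∈ C
        s∈C = U′∖X⊆C s∈U′ s∉X

  simplicial-exists : Chordal H → ∀ {U v} → v ∈ U → ∃ λ s → s ∈ U × Simplicial U s
  simplicial-exists chordal {U} v∈U
    with s , s∈U , _ , simplicial ←
           simplicial-outside-clique chordal U ∅ (λ _ _ x∈∅ → ⊥-elim (∉⊥ x∈∅)) v∈U ∉⊥ =
    s , s∈U , simplicial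

  CliqueBounded : Subset n → ℕ → Set
  CliqueBounded U b = ∀ K → K ⊆ U → IsClique H K → ∣ K ∣ ≤ b

  extend-colouring : ∀ {b U s} (L : Assignment n b) → s ∈ U → Simplicial U s → CliqueBounded U b →
    InducedColourable H L (U ∖ s) → InducedColourable H L U
  extend-colouring {b} {U} {s} L s∈U simplicial bounded (c′ , c′∈L , c′-proper) =
    colour , colour∈L , colour-proper
    where
    N : Subset n
    N = select (λ w → w ∈? U ∖ s ×-dec Adj? s w)
    K : Subset n
    K = N ∪ ⁅ s ⁆
    K⊆U : K ⊆ U
    K⊆U w∈K with x∈p∪q⁻ N ⁅ s ⁆ w∈K
    ... | inj₁ w∈N = proj₁ (∈-select⁻ (proj₁ (∈-select⁻ w∈N)))
    ... | inj₂ w∈⁅s⁆ with refl ← x∈⁅y⁆⇒x≡y s w∈⁅s⁆ = s∈U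
    K-clique : IsClique H K
    K-clique a b a∈K b∈K a≢b with x∈p∪q⁻ N ⁅ s ⁆ a∈K | x∈p∪q⁻ N ⁅ s ⁆ b∈K
    ... | inj₁ a∈N | inj₁ b∈N =
      simplicial (K⊆U a∈K) (K⊆U b∈K) (proj₂ (∈-select⁻ a∈N)) (proj₂ (∈-select⁻ b∈N)) a≢b
    ... | inj₁ a∈N | inj₂ b∈⁅s⁆ with refl ← x∈⁅y⁆⇒x≡y s b∈⁅s⁆ = Adj-sym (proj₂ (∈-select⁻ a∈N))
    ... | inj₂ a∈⁅s⁆ | inj₁ b∈N with refl ← x∈⁅y⁆⇒x≡y s a∈⁅s⁆ = proj₂ (∈-select⁻ b∈N)
    ... | inj₂ a∈⁅s⁆ | inj₂ b∈⁅s⁆ =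
      ⊥-elim (a≢b (trans (x∈⁅y⁆⇒x≡y s a∈⁅s⁆) (sym (x∈⁅y⁆⇒x≡y s b∈⁅s⁆))))
    ∣N∣<b : ∣ N ∣ < length (lst L s)
    ∣N∣<b = subst (∣ N ∣ <_) (sym (size L s))
      (<-≤-trans (p⊂q⇒∣p∣<∣q∣ (p⊆p∪q ⁅ s ⁆ , s , x∈p∪q⁺ (inj₂ (x∈⁅x⁆ s)) , Adj-irrefl ∘ proj₂ ∘ ∈-select⁻))
                 (bounded K K⊆U K-clique))
    free : ∃ λ x → x ∈ₗ lst L s × (∀ {w} → w ∈ N → c′ w ≢ x)
    free = ∃-∉-image _≟_ (unique L s) N ∣N∣<b c′
    colour : Fin n → ℕ
    colour w with w ≟ᶠ s
    ... | yes _ = proj₁ free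
    ... | no _ = c′ w
    colour∈L : ∀ w → w ∈ U → colour w ∈ₗ lst L w
    colour∈L w w∈U with w ≟ᶠ s
    ... | yes refl = proj₁ (proj₂ free)
    ... | no w≢s = c′∈L w (∈-select⁺ (w∈U , w≢s))
    colour-proper : ∀ a b → a ∈ U → b ∈ U → Adj H a b → colour a ≢ colour b
    colour-proper a b a∈U b∈U a~b with a ≟ᶠ s | b ≟ᶠ s
    ... | yes refl | yes refl = ⊥-elim (Adj-irrefl a~b)
    ... | yes refl | no b≢s = proj₂ (proj₂ free) (∈-select⁺ (∈-select⁺ (b∈U , b≢s) , a~b)) ∘ sym
    ... | no a≢s | yes refl = proj₂ (proj₂ free) (∈-select⁺ (∈-select⁺ (a∈U , a≢s) , Adj-sym a~b))
    ... | no a≢s | no b≢s = c′-proper a b (∈-select⁺ (a∈U , a≢s)) (∈-select⁺ (b∈U , b≢s)) a~b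

  chordal-colourable : Chordal H → ∀ {b} (L : Assignment n b) U → CliqueBounded U b → InducedColourable H L U
  chordal-colourable chordal L U = go U (<-wellFounded ∣ U ∣)
    where
    go : ∀ U → Acc _<_ ∣ U ∣ → CliqueBounded U _ → InducedColourable H L U
    go U (acc smaller) bounded with nonempty? U
    ... | no empty =
      (λ _ → 0) , (λ v v∈U → ⊥-elim (empty (v , v∈U))) , λ u _ u∈U → ⊥-elim (empty (u , u∈U))
    ... | yes (v , v∈U) with s , s∈U , simplicial ← simplicial-exists chordal v∈U =
      extend-colouring L s∈U simplicial bounded
        (go (U ∖ s) (smaller (p⊂q⇒∣p∣<∣q∣ (U∖s⊆U , s , s∈U , λ s∈U∖s → proj₂ (∈-select⁻ s∈U∖s) refl)))
            (λ K K⊆U∖s → bounded K (U∖s⊆U ∘ K⊆U∖s)))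
      where
      U∖s⊆U : U ∖ s ⊆ U
      U∖s⊆U = proj₁ ∘ ∈-select⁻

-- Windows of colour classes

module Windows (k : ℕ) .{{_ : NonZero k}} {n t} (t≤k : t ≤ k) (f : Fin n → ℕ) where

  in-window? : (j : Fin k) (v : Fin n) → Dec ((toℕ j + f v) % k < t)
  in-window? j v = (toℕ j + f v) % k <? t

  window : Fin k → Subset n
  window j = select (in-window? j)

  ∑-∣window∣ : ∑[ j < k ] ∣ window j ∣ ≡ t * n
  ∑-∣window∣ = begin
    ∑[ j < k ] ∣ window j ∣                         ≡⟨ sum-cong-≗ {k} (λ j → ∣select∣≡∑ (in-window? j)) ⟩
    ∑[ j < k ] ∑[ v < n ] 𝟙 (does (in-window? j v))  ≡⟨ ∑-comm {k} {n} (λ j v → 𝟙 (does (in-window? j v))) ⟩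
    ∑[ v < n ] ∑[ j < k ] 𝟙 (does (in-window? j v))  ≡⟨ sum-cong-≗ {n} (λ v → window-count k t≤k (f v)) ⟩
    ∑[ v < n ] t                                    ≡⟨ ∑-const n t ⟩
    n * t                                           ≡⟨ *-comm n t ⟩
    t * n                                           ∎
    where open ≡-Reasoning

  ∃-large-window : ∃ λ j → t * n ≤ k * ∣ window j ∣
  ∃-large-window with j , above-average ← ∃-≥-average (∣_∣ ∘ window) =
    j , subst (_≤ k * ∣ window j ∣) ∑-∣window∣ above-average

  window-clique-bounded : (H : Graph n) → (∀ v → f v < k) → (∀ {u v} → Adj H u v → f u ≢ f v) →
    ∀ j → CliqueBounded H (window j) t
  window-clique-bounded H f<k proper j K K⊆window K-clique =
    subst (∣ K ∣ ≤_) (length-upTo t)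
      (∣p∣≤length-by-injection (λ v → (toℕ j + f v) % k) (λ v∈K → ∈-upTo⁺ (∈-select⁻ (K⊆window v∈K))) injective)
    where
    injective : ∀ {u v} → u ∈ K → v ∈ K → (toℕ j + f u) % k ≡ (toℕ j + f v) % k → u ≡ v
    injective {u} {v} u∈K v∈K eq with u ≟ᶠ v
    ... | yes u≡v = u≡v
    ... | no u≢v = ⊥-elim (proper (K-clique u v u∈K v∈K u≢v) ([j+a]%k-injective k (toℕ j) (f<k u) (f<k v) eq))

uniform-assignment : ∀ n k → Assignment n k
uniform-assignment n k = record { lst = λ _ → upTo k ; size = λ _ → length-upTo k ; unique = λ _ → upTo⁺ k }

large-colourable-subset : ∀ {n k t} (H : Graph n) → Chordal H → (∀ K → IsClique H K → ∣ K ∣ ≤ k) →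
  t ≤ k → .{{_ : NonZero k}} → (L : Assignment n t) → ∃ λ S → InducedColourable H L S × t * n ≤ k * ∣ S ∣
large-colourable-subset {n} {k} {t} H chordal ω≤k t≤k L
  with f , f∈upTo , f-proper ← chordal-colourable H chordal (uniform-assignment n k) ⊤ (λ K _ → ω≤k K) =
  colour-window ∃-large-window
  where
  open Windows k t≤k f
  f<k : ∀ v → f v < k
  f<k v = ∈-upTo⁻ (f∈upTo v ∈⊤)
  proper : ∀ {u v} → Adj H u v → f u ≢ f v
  proper {u} {v} = f-proper u v ∈⊤ ∈⊤
  colour-window : ∃ (λ j → t * n ≤ k * ∣ window j ∣) → ∃ λ S → InducedColourable H L S × t * n ≤ k * ∣ S ∣
  colour-window (j , large) =
    window j , chordal-colourable H chordal L (window j) (window-clique-bounded H f<k proper j) , large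

colourable-from-supergraph : ∀ {n b} {G H : Graph n} {L : Assignment n b} {S} → Supergraph G H →
  InducedColourable H L S → InducedColourable G L S
colourable-from-supergraph G⊆H (c , c∈L , proper) =
  c , c∈L , λ u v u∈S v∈S u~v → proper u v u∈S v∈S (G⊆H u v u~v)

chordal-supergraph-choosable : ∀ {n k} {G H : Graph n} → Supergraph G H → Chordal H →
  (∀ K → IsClique H K → ∣ K ∣ ≤ k) → Choosable G k
chordal-supergraph-choosable {G = G} {H} G⊆H chordal ω≤k L
  with c , c∈L , proper ← colourable-from-supergraph {G = G} {H} {L = L} {⊤} G⊆H
                            (chordal-colourable H chordal L ⊤ (λ K _ → ω≤k K)) =
  c , (λ v → c∈L v ∈⊤) , λ u v → proper u v ∈⊤ ∈⊤

mainTheorem8 : (n : ℕ) (G : Graph n) (s t k lam : ℕ) →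
    IsListChromaticNumber G s → IsTreewidthPlusOne G k →
    1 ≤ t → t < s → IsLambda G t lam →
    t * n ≤ lam * k
mainTheorem8 n G s t k lam (_ , ¬choosable) ((H , G⊆H , chordal , _ , ω≤k) , _) _ t<s ((L , _ , maximal) , _)
  with t<k ← <-≤-trans t<s (≮⇒≥ λ k<s → ¬choosable k k<s (chordal-supergraph-choosable {G = G} G⊆H chordal ω≤k))
  with S , S-colourable , large ←
         large-colourable-subset H chordal ω≤k (<⇒≤ t<k) {{>-nonZero (≤-<-trans z≤n t<k)}} L =
  begin
    t * n     ≤⟨ large ⟩
    k * ∣ S ∣ ≤⟨ *-monoʳ-≤ k (maximal S (colourable-from-supergraph {G = G} {H} {L = L} {S} G⊆H S-colourable)) ⟩
    k * lam   ≡⟨ *-comm k lam ⟩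
    lam * k   ∎
  where open ≤-Reasoning
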